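{- If $\mathcal{H}$ is a $3$-graph on $n$ vertices with $\delta_2(\mathcal{H})>(n-3)/2$, then all the edges of $\mathcal{H}$ belong to a single tight component. Moreover, for each $n\in\mathbb{N}$, there exists a $3$-graph $\mathcal{H}$ on $n$ vertices with $\delta_2(\mathcal{H})=\lfloor (n-3)/2\rfloor$ whose edge set decomposes into two tight components.
   Context: A $3$-graph $\mathcal{H}$ consists of a finite vertex set and a set of $3$-element subsets (edges). $\delta_2(\mathcal{H})$ is the minimum, over pairs of distinct vertices $x,y$, of the number of edges containing both $x$ and $y$. Two edges touch if they intersect in exactly two vertices; a tight component of $\mathcal{H}$ is an equivalence class of edges under the transitive closure of the touching relation. -}

module Defs where

open import Data.Nat using (ℕ; _*_; _+_; _<_; _≤_; _∸_; _/_)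
open import Data.Bool using (Bool; true)
open import Data.Fin using (Fin)
open import Data.Fin.Subset using (Subset; ⁅_⁆; _∪_; _∩_; ∣_∣)
open import Data.List using (length; filterᵇ; allFin)
open import Data.Product using (_×_; ∃; ∃-syntax; _,_)
open import Data.Sum using (_⊎_)
open import Relation.Binary.PropositionalEquality using (_≡_)
open import Relation.Nullary using (¬_)
open import Relation.Binary.Construct.Closure.ReflexiveTransitive using (Star)

record ThreeGraph (n : ℕ) : Set where
  field
    edge    : Subset n → Bool
    edge-3  : ∀ e → edge e ≡ true → ∣ e ∣ ≡ 3
open ThreeGraph public

IsEdge : ∀ {n} → ThreeGraph n → Subset n → Set
IsEdge H e = edge H e ≡ true

triple : ∀ {n} → Fin n → Fin n → Fin n → Subset n
triple x y z = ⁅ x ⁆ ∪ (⁅ y ⁆ ∪ ⁅ z ⁆)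

-- codegree of the pair x,y: number of edges containing both x and y,
-- counted via the third vertex z (for x ≠ y an edge ⊇ {x,y} is {x,y,z}
-- for a unique z ∉ {x,y}; triples with z ∈ {x,y} have size 2, never edges).
codeg : ∀ {n} → ThreeGraph n → Fin n → Fin n → ℕ
codeg H x y = length (filterᵇ (λ z → edge H (triple x y z)) (allFin _))

MinCodegree : ∀ {n} → ThreeGraph n → ℕ → Set
MinCodegree H k =
  (∀ x y → ¬ x ≡ y → k ≤ codeg H x y) × (∃[ x ] ∃[ y ] (¬ x ≡ y × codeg H x y ≡ k))

-- δ₂(H) > (n-3)/2, i.e. 2·codeg(x,y) > n - 3 for all distinct x,y
MinCodegreeAboveHalf : ∀ {n} → ThreeGraph n → Set
MinCodegreeAboveHalf {n} H = ∀ x y → ¬ x ≡ y → n < 2 * codeg H x y + 3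

Touch : ∀ {n} → ThreeGraph n → Subset n → Subset n → Set
Touch H e f = IsEdge H e × IsEdge H f × ∣ e ∩ f ∣ ≡ 2

SameTightComponent : ∀ {n} → ThreeGraph n → Subset n → Subset n → Set
SameTightComponent H = Star (Touch H)

TightlyConnected : ∀ {n} → ThreeGraph n → Set
TightlyConnected H = ∀ e f → IsEdge H e → IsEdge H f → SameTightComponent H e f

TwoTightComponents : ∀ {n} → ThreeGraph n → Set
TwoTightComponents H =
  ∃[ e₁ ] ∃[ e₂ ] (IsEdge H e₁ × IsEdge H e₂ × ¬ SameTightComponent H e₁ e₂
    × (∀ f → IsEdge H f → SameTightComponent H e₁ f ⊎ SameTightComponent H e₂ f))

-- (1) Edges {a,b,c}, {a,d,e} through a common vertex are linked by a "bridge":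
-- b = d, or {a,b,d} is an edge, or {a,b,w}, {a,d,w} are edges for some w.  If
-- there is none, N(a,b), N(a,d) and {a,b,d} are disjoint, so
-- codeg(a,b) + codeg(a,d) + 3 ≤ n, contradicting the codegree condition.  Edges
-- {a,..}, {d,..} with a ≠ d are both linked to an edge {a,d,w}.
-- (2) Split the vertices into A (k + 3 vertices) and B (k + 2 or k + 3) and take
-- the triples meeting A oddly.  Touching preserves lying inside A, and bridges
-- link every edge to {α₀,α₁,α₂} ⊆ A or to {α₀,β₀,β₁}.
module Submission where

open import Defs
open import Data.Nat using (ℕ; _≤_; _∸_; _/_)
open import Data.Product using (_×_; ∃-syntax)

open import Data.Nat as ℕ using (zero; suc; _+_; _*_; _<_; _%_; z≤n; s≤s)
open import Data.Nat.Properties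
  using ( ≤-refl; ≤-trans; ≤-antisym; <⇒≱; >⇒≢; m≤m+n; m≤n+m; +-suc; +-identityʳ; +-mono-≤
        ; *-cancelˡ-≤; suc-injective; 1+n≢0; m+n∸m≡n; module ≤-Reasoning)
open import Data.Nat.DivMod using (m≡m%n+[m/n]*n; m/n≡1+[m∸n]/n)
open import Data.Nat.Solver using (module +-*-Solver)
open import Data.Bool as Bool using (Bool; true; false; if_then_else_)
open import Data.Fin as Fin using (Fin; _≟_; _↑ʳ_)
open import Data.Fin.Properties using (any?; ↑ʳ-injective)
open import Data.Fin.Subset
  using (Subset; _∈_; _∉_; _⊆_; ⁅_⁆; _∪_; _∩_; ∁; ⊤; ⊥; ∣_∣; Nonempty; Empty)
open import Data.Fin.Subset.Properties
open import Data.Vec as Vec using (_∷_; []; here; there)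
open import Data.Vec.Properties
  using (lookup∘tabulate; []=⇒lookup; lookup⇒[]=; tabulate-cong; lookup-++ʳ; lookup-replicate)
open import Data.List as List using (length; filterᵇ)
open import Data.Product using (_,_; proj₁; proj₂)
open import Data.Sum using (_⊎_; inj₁; inj₂)
open import Function using (_∘_)
open import Relation.Nullary using (¬_; Dec; yes; no; does; contradiction)
open import Relation.Nullary.Decidable using (does-≡; dec-true; _×-dec_; _⊎-dec_)
open import Relation.Binary.Construct.Closure.ReflexiveTransitive using (ε; _◅_; _◅◅_)
open import Relation.Binary.PropositionalEquality

private variable
  n k : ℕ

∣p∪q∣+∣p∩q∣≡∣p∣+∣q∣ : (p q : Subset n) → ∣ p ∪ q ∣ + ∣ p ∩ q ∣ ≡ ∣ p ∣ + ∣ q ∣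
∣p∪q∣+∣p∩q∣≡∣p∣+∣q∣ [] [] = refl
∣p∪q∣+∣p∩q∣≡∣p∣+∣q∣ (true ∷ p) (true ∷ q) =
  cong suc (trans (+-suc _ _) (trans (cong suc (∣p∪q∣+∣p∩q∣≡∣p∣+∣q∣ p q)) (sym (+-suc _ _))))
∣p∪q∣+∣p∩q∣≡∣p∣+∣q∣ (true ∷ p) (false ∷ q) = cong suc (∣p∪q∣+∣p∩q∣≡∣p∣+∣q∣ p q)
∣p∪q∣+∣p∩q∣≡∣p∣+∣q∣ (false ∷ p) (true ∷ q) =
  trans (cong suc (∣p∪q∣+∣p∩q∣≡∣p∣+∣q∣ p q)) (sym (+-suc _ _))
∣p∪q∣+∣p∩q∣≡∣p∣+∣q∣ (false ∷ p) (false ∷ q) = ∣p∪q∣+∣p∩q∣≡∣p∣+∣q∣ p q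

∣p∪q∣≤∣p∣+∣q∣ : (p q : Subset n) → ∣ p ∪ q ∣ ≤ ∣ p ∣ + ∣ q ∣
∣p∪q∣≤∣p∣+∣q∣ p q = subst (∣ p ∪ q ∣ ≤_) (∣p∪q∣+∣p∩q∣≡∣p∣+∣q∣ p q) (m≤m+n _ _)

∣p∪q∣-disjoint : (p q : Subset n) → (∀ {x} → x ∈ p → x ∉ q) → ∣ p ∪ q ∣ ≡ ∣ p ∣ + ∣ q ∣
∣p∪q∣-disjoint {n} p q disjoint = begin
  ∣ p ∪ q ∣              ≡⟨ sym (+-identityʳ _) ⟩
  ∣ p ∪ q ∣ + 0          ≡⟨ cong (∣ p ∪ q ∣ +_) (sym (∣⊥∣≡0 n)) ⟩
  ∣ p ∪ q ∣ + ∣ ⊥ {n} ∣  ≡⟨ cong (λ s → ∣ p ∪ q ∣ + ∣ s ∣) (sym (Empty-unique p∩q-empty)) ⟩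
  ∣ p ∪ q ∣ + ∣ p ∩ q ∣  ≡⟨ ∣p∪q∣+∣p∩q∣≡∣p∣+∣q∣ p q ⟩
  ∣ p ∣ + ∣ q ∣          ∎
  where
  open ≡-Reasoning
  p∩q-empty : Empty (p ∩ q)
  p∩q-empty (x , x∈p∩q) = let (x∈p , x∈q) = x∈p∩q⁻ p q x∈p∩q in disjoint x∈p x∈q

-- Two subsets of p meeting r: a p-vertex counted by both ∣ p ∩ q ∣ and
-- ∣ p ∩ r ∣ lies in q ∩ r, hence  ∣ p ∩ q ∣ + ∣ p ∩ r ∣ ≤ ∣ p ∣ + ∣ q ∩ r ∣.
overlap-bound : (p q r : Subset n) → ∣ p ∩ q ∣ + ∣ p ∩ r ∣ ≤ ∣ p ∣ + ∣ q ∩ r ∣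
overlap-bound p q r =
  subst (_≤ ∣ p ∣ + ∣ q ∩ r ∣) (∣p∪q∣+∣p∩q∣≡∣p∣+∣q∣ (p ∩ q) (p ∩ r))
    (+-mono-≤ (p⊆q⇒∣p∣≤∣q∣ union⊆p) (p⊆q⇒∣p∣≤∣q∣ meet⊆q∩r))
  where
  union⊆p : (p ∩ q) ∪ (p ∩ r) ⊆ p
  union⊆p m with x∈p∪q⁻ (p ∩ q) (p ∩ r) m
  ... | inj₁ m₁ = proj₁ (x∈p∩q⁻ p q m₁)
  ... | inj₂ m₂ = proj₁ (x∈p∩q⁻ p r m₂)
  meet⊆q∩r : (p ∩ q) ∩ (p ∩ r) ⊆ q ∩ r
  meet⊆q∩r m = let (m₁ , m₂) = x∈p∩q⁻ (p ∩ q) (p ∩ r) m in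
    x∈p∩q⁺ (proj₂ (x∈p∩q⁻ p q m₁) , proj₂ (x∈p∩q⁻ p r m₂))

infixl 8 _∖_
_∖_ : Subset n → Fin n → Subset n
p ∖ x = p ∩ ∁ ⁅ x ⁆

∈∖⁻ : {p : Subset n} {x y : Fin n} → y ∈ p ∖ x → y ∈ p × y ≢ x
∈∖⁻ {p = p} {x} m =
  let (y∈p , y∈∁x) = x∈p∩q⁻ p (∁ ⁅ x ⁆) m in y∈p , x∉⁅y⁆⇒x≢y (x∈∁p⇒x∉p y∈∁x)

∈∖⁺ : {p : Subset n} {x y : Fin n} → y ∈ p → y ≢ x → y ∈ p ∖ x
∈∖⁺ y∈p y≢x = x∈p∩q⁺ (y∈p , x∉p⇒x∈∁p (x≢y⇒x∉⁅y⁆ y≢x))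

∈⇒≡⁅⁆∪∖ : {p : Subset n} {x : Fin n} → x ∈ p → p ≡ ⁅ x ⁆ ∪ p ∖ x
∈⇒≡⁅⁆∪∖ {p = p} {x} x∈p = ⊆-antisym into back
  where
  into : p ⊆ ⁅ x ⁆ ∪ p ∖ x
  into {y} y∈p with y ≟ x
  ... | yes refl = x∈p∪q⁺ (inj₁ (x∈⁅x⁆ x))
  ... | no y≢x   = x∈p∪q⁺ (inj₂ (∈∖⁺ y∈p y≢x))
  back : ⁅ x ⁆ ∪ p ∖ x ⊆ p
  back m with x∈p∪q⁻ ⁅ x ⁆ (p ∖ x) m
  ... | inj₁ y∈⁅x⁆ = subst (_∈ p) (sym (x∈⁅y⁆⇒x≡y x y∈⁅x⁆)) x∈p
  ... | inj₂ y∈p∖x = proj₁ (∈∖⁻ y∈p∖x)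

∣p∣≡1+∣p∖x∣ : {p : Subset n} {x : Fin n} → x ∈ p → ∣ p ∣ ≡ suc ∣ p ∖ x ∣
∣p∣≡1+∣p∖x∣ {p = p} {x} x∈p = begin
  ∣ p ∣                 ≡⟨ cong ∣_∣ (∈⇒≡⁅⁆∪∖ x∈p) ⟩
  ∣ ⁅ x ⁆ ∪ p ∖ x ∣     ≡⟨ ∣p∪q∣-disjoint ⁅ x ⁆ (p ∖ x) x-removed ⟩
  ∣ ⁅ x ⁆ ∣ + ∣ p ∖ x ∣ ≡⟨ cong (_+ ∣ p ∖ x ∣) (∣⁅x⁆∣≡1 x) ⟩
  suc ∣ p ∖ x ∣         ∎
  where
  open ≡-Reasoning
  x-removed : ∀ {y} → y ∈ ⁅ x ⁆ → y ∉ p ∖ x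
  x-removed y∈⁅x⁆ y∈p∖x = proj₂ (∈∖⁻ y∈p∖x) (x∈⁅y⁆⇒x≡y x y∈⁅x⁆)

∣p∣≡2+∣p∖x∖y∣ : {p : Subset n} {x y : Fin n} → x ∈ p → y ∈ p → x ≢ y →
                ∣ p ∣ ≡ suc (suc ∣ p ∖ x ∖ y ∣)
∣p∣≡2+∣p∖x∖y∣ x∈p y∈p x≢y =
  trans (∣p∣≡1+∣p∖x∣ x∈p) (cong suc (∣p∣≡1+∣p∖x∣ (∈∖⁺ y∈p (x≢y ∘ sym))))

0<∣p∣⇒Nonempty : {p : Subset n} → 0 < ∣ p ∣ → Nonempty p
0<∣p∣⇒Nonempty {n} {p = p} positive with nonempty? p
... | yes ne = ne
... | no empty = contradiction (trans (cong ∣_∣ (Empty-unique empty)) (∣⊥∣≡0 n)) (>⇒≢ positive)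

∣p∣≡0⇒p≡⊥ : {p : Subset n} → ∣ p ∣ ≡ 0 → p ≡ ⊥
∣p∣≡0⇒p≡⊥ size = Empty-unique λ (x , x∈p) → 1+n≢0 (trans (sym (∣p∣≡1+∣p∖x∣ x∈p)) size)

peel : {p : Subset n} → ∣ p ∣ ≡ suc k → ∃[ x ] (p ≡ ⁅ x ⁆ ∪ p ∖ x × ∣ p ∖ x ∣ ≡ k)
peel size with 0<∣p∣⇒Nonempty (subst (0 <_) (sym size) (s≤s z≤n))
... | x , x∈p = x , ∈⇒≡⁅⁆∪∖ x∈p , suc-injective (trans (sym (∣p∣≡1+∣p∖x∣ x∈p)) size)

private variable
  x y z w : Fin n
  p : Subset n

∈triple⁻ : w ∈ triple x y z → w ≡ x ⊎ w ≡ y ⊎ w ≡ z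
∈triple⁻ {x = x} {y} {z} m with x∈p∪q⁻ ⁅ x ⁆ (⁅ y ⁆ ∪ ⁅ z ⁆) m
... | inj₁ w∈x = inj₁ (x∈⁅y⁆⇒x≡y x w∈x)
... | inj₂ w∈yz with x∈p∪q⁻ ⁅ y ⁆ ⁅ z ⁆ w∈yz
...   | inj₁ w∈y = inj₂ (inj₁ (x∈⁅y⁆⇒x≡y y w∈y))
...   | inj₂ w∈z = inj₂ (inj₂ (x∈⁅y⁆⇒x≡y z w∈z))

∈triple₁ : x ∈ triple x y z
∈triple₁ {x = x} = x∈p∪q⁺ (inj₁ (x∈⁅x⁆ x))

∈triple₂ : y ∈ triple x y z
∈triple₂ {y = y} = x∈p∪q⁺ (inj₂ (x∈p∪q⁺ (inj₁ (x∈⁅x⁆ y))))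

triple-swap₁₂ : triple x y z ≡ triple y x z
triple-swap₁₂ {x = x} {y = y} {z = z} = begin
  ⁅ x ⁆ ∪ (⁅ y ⁆ ∪ ⁅ z ⁆)   ≡⟨ sym (∪-assoc ⁅ x ⁆ ⁅ y ⁆ ⁅ z ⁆) ⟩
  (⁅ x ⁆ ∪ ⁅ y ⁆) ∪ ⁅ z ⁆   ≡⟨ cong (_∪ ⁅ z ⁆) (∪-comm ⁅ x ⁆ ⁅ y ⁆) ⟩
  (⁅ y ⁆ ∪ ⁅ x ⁆) ∪ ⁅ z ⁆   ≡⟨ ∪-assoc ⁅ y ⁆ ⁅ x ⁆ ⁅ z ⁆ ⟩
  ⁅ y ⁆ ∪ (⁅ x ⁆ ∪ ⁅ z ⁆)   ∎
  where open ≡-Reasoning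

triple-swap₂₃ : triple x y z ≡ triple x z y
triple-swap₂₃ {x = x} {y = y} {z = z} = cong (⁅ x ⁆ ∪_) (∪-comm ⁅ y ⁆ ⁅ z ⁆)

triple-rotate : triple x y z ≡ triple y z x
triple-rotate = trans triple-swap₁₂ triple-swap₂₃

-- Every 3-element set has the form {x, y, z}.  The proof is kept opaque: it is
-- only ever used through its statement, and unfolding it is expensive.
opaque
  ∣e∣≡3⇒triple : {e : Subset n} → ∣ e ∣ ≡ 3 → ∃[ x ] ∃[ y ] ∃[ z ] (e ≡ triple x y z)
  ∣e∣≡3⇒triple {e = e} size with peel size
  ... | x , e≡x∪e₁ , size₁ with peel size₁
  ... | y , e₁≡y∪e₂ , size₂ with peel size₂
  ... | z , e₂≡z∪e₃ , size₃ = x , y , z , (begin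
    e                                  ≡⟨ e≡x∪e₁ ⟩
    ⁅ x ⁆ ∪ e ∖ x                      ≡⟨ cong (⁅ x ⁆ ∪_) e₁≡y∪e₂ ⟩
    ⁅ x ⁆ ∪ (⁅ y ⁆ ∪ e ∖ x ∖ y)        ≡⟨ cong (λ s → ⁅ x ⁆ ∪ (⁅ y ⁆ ∪ s)) e₂≡z∪e₃ ⟩
    ⁅ x ⁆ ∪ (⁅ y ⁆ ∪ (⁅ z ⁆ ∪ e ∖ x ∖ y ∖ z))
      ≡⟨ cong (λ s → ⁅ x ⁆ ∪ (⁅ y ⁆ ∪ (⁅ z ⁆ ∪ s))) (∣p∣≡0⇒p≡⊥ size₃) ⟩
    ⁅ x ⁆ ∪ (⁅ y ⁆ ∪ (⁅ z ⁆ ∪ ⊥))     ≡⟨ cong (λ s → ⁅ x ⁆ ∪ (⁅ y ⁆ ∪ s)) (∪-identityʳ ⁅ z ⁆) ⟩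
    triple x y z                       ∎)
    where open ≡-Reasoning

Distinct : Fin n → Fin n → Fin n → Set
Distinct x y z = x ≢ y × x ≢ z × y ≢ z

∣triple-x-x-z∣≤2 : ∣ triple x x z ∣ ≤ 2
∣triple-x-x-z∣≤2 {x = x} {z = z} = begin
  ∣ ⁅ x ⁆ ∪ (⁅ x ⁆ ∪ ⁅ z ⁆) ∣ ≡⟨ cong ∣_∣ (sym (∪-assoc ⁅ x ⁆ ⁅ x ⁆ ⁅ z ⁆)) ⟩
  ∣ (⁅ x ⁆ ∪ ⁅ x ⁆) ∪ ⁅ z ⁆ ∣ ≡⟨ cong (λ s → ∣ s ∪ ⁅ z ⁆ ∣) (∪-idem ⁅ x ⁆) ⟩
  ∣ ⁅ x ⁆ ∪ ⁅ z ⁆ ∣           ≤⟨ ∣p∪q∣≤∣p∣+∣q∣ ⁅ x ⁆ ⁅ z ⁆ ⟩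
  ∣ ⁅ x ⁆ ∣ + ∣ ⁅ z ⁆ ∣       ≡⟨ cong₂ _+_ (∣⁅x⁆∣≡1 x) (∣⁅x⁆∣≡1 z) ⟩
  2                           ∎
  where open ≤-Reasoning

∣triple∣≡3⇒Distinct : ∣ triple x y z ∣ ≡ 3 → Distinct x y z
∣triple∣≡3⇒Distinct {x = x} {y} {z} size = x≢y , x≢z , y≢z
  where
  not-repeated : ∀ {u v} → triple x y z ≢ triple u u v
  not-repeated {u} {v} eq =
    <⇒≱ ≤-refl (subst (_≤ 2) (trans (cong ∣_∣ (sym eq)) size) (∣triple-x-x-z∣≤2 {x = u} {z = v}))
  x≢y : x ≢ y
  x≢y refl = not-repeated refl
  x≢z : x ≢ z
  x≢z refl = not-repeated triple-swap₂₃
  y≢z : y ≢ z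
  y≢z refl = not-repeated triple-rotate

⟦_⟧ : {P : Set} → Dec P → ℕ
⟦ d ⟧ = if does d then 1 else 0

indicator : Subset n → Fin n → ℕ
indicator p x = ⟦ x ∈? p ⟧

indicator≡⟦⟧ : (d : Dec (x ∈ p)) → indicator p x ≡ ⟦ d ⟧
indicator≡⟦⟧ {x = x} {p = p} d = cong (if_then 1 else 0) (does-≡ (x ∈? p) d)

indicator-∈ : x ∈ p → indicator p x ≡ 1
indicator-∈ x∈p = indicator≡⟦⟧ (yes x∈p)

indicator-∉ : x ∉ p → indicator p x ≡ 0
indicator-∉ x∉p = indicator≡⟦⟧ (no x∉p)

∣⁅x⁆∩p∣≡indicator : (p : Subset n) (x : Fin n) → ∣ ⁅ x ⁆ ∩ p ∣ ≡ indicator p x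
∣⁅x⁆∩p∣≡indicator {n} p x with x ∈? p
... | yes x∈p = trans (cong ∣_∣ ⁅x⁆∩p≡⁅x⁆) (∣⁅x⁆∣≡1 x)
  where
  ⁅x⁆∩p≡⁅x⁆ : ⁅ x ⁆ ∩ p ≡ ⁅ x ⁆
  ⁅x⁆∩p≡⁅x⁆ = ⊆-antisym (p∩q⊆p ⁅ x ⁆ p)
    (λ y∈⁅x⁆ → x∈p∩q⁺ (y∈⁅x⁆ , subst (_∈ p) (sym (x∈⁅y⁆⇒x≡y x y∈⁅x⁆)) x∈p))
... | no x∉p = trans (cong ∣_∣ ⁅x⁆∩p≡⊥) (∣⊥∣≡0 n)
  where
  ⁅x⁆∩p≡⊥ : ⁅ x ⁆ ∩ p ≡ ⊥
  ⁅x⁆∩p≡⊥ = Empty-unique λ (y , y∈⁅x⁆∩p) →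
    let (y∈⁅x⁆ , y∈p) = x∈p∩q⁻ ⁅ x ⁆ p y∈⁅x⁆∩p in x∉p (subst (_∈ p) (x∈⁅y⁆⇒x≡y x y∈⁅x⁆) y∈p)

∣⁅x⁆∪q∩p∣ : (p q : Subset n) (x : Fin n) → x ∉ q →
            ∣ (⁅ x ⁆ ∪ q) ∩ p ∣ ≡ indicator p x + ∣ q ∩ p ∣
∣⁅x⁆∪q∩p∣ p q x x∉q = begin
  ∣ (⁅ x ⁆ ∪ q) ∩ p ∣           ≡⟨ cong ∣_∣ (∩-distribʳ-∪ p ⁅ x ⁆ q) ⟩
  ∣ (⁅ x ⁆ ∩ p) ∪ (q ∩ p) ∣     ≡⟨ ∣p∪q∣-disjoint (⁅ x ⁆ ∩ p) (q ∩ p) disjoint ⟩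
  ∣ ⁅ x ⁆ ∩ p ∣ + ∣ q ∩ p ∣     ≡⟨ cong (_+ ∣ q ∩ p ∣) (∣⁅x⁆∩p∣≡indicator p x) ⟩
  indicator p x + ∣ q ∩ p ∣     ∎
  where
  open ≡-Reasoning
  disjoint : ∀ {y} → y ∈ ⁅ x ⁆ ∩ p → y ∉ q ∩ p
  disjoint y∈⁅x⁆∩p y∈q∩p =
    x∉q (subst (_∈ q) (x∈⁅y⁆⇒x≡y x (proj₁ (x∈p∩q⁻ ⁅ x ⁆ p y∈⁅x⁆∩p))) (proj₁ (x∈p∩q⁻ q p y∈q∩p)))

∣triple∩p∣ : (p : Subset n) → Distinct x y z →
             ∣ triple x y z ∩ p ∣ ≡ indicator p x + (indicator p y + indicator p z)
∣triple∩p∣ {x = x} {y} {z} p (x≢y , x≢z , y≢z) =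
  trans (∣⁅x⁆∪q∩p∣ p (⁅ y ⁆ ∪ ⁅ z ⁆) x x∉yz)
    (cong (indicator p x +_)
      (trans (∣⁅x⁆∪q∩p∣ p ⁅ z ⁆ y (x≢y⇒x∉⁅y⁆ y≢z)) (cong (indicator p y +_) (∣⁅x⁆∩p∣≡indicator p z))))
  where
  x∉yz : x ∉ ⁅ y ⁆ ∪ ⁅ z ⁆
  x∉yz m with x∈p∪q⁻ ⁅ y ⁆ ⁅ z ⁆ m
  ... | inj₁ x∈y = x≢y (x∈⁅y⁆⇒x≡y y x∈y)
  ... | inj₂ x∈z = x≢z (x∈⁅y⁆⇒x≡y z x∈z)

∣triple∣≡3 : Distinct x y z → ∣ triple x y z ∣ ≡ 3
∣triple∣≡3 {x = x} {y} {z} distinct = begin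
  ∣ triple x y z ∣       ≡⟨ cong ∣_∣ (sym (∩-identityʳ (triple x y z))) ⟩
  ∣ triple x y z ∩ ⊤ ∣   ≡⟨ ∣triple∩p∣ ⊤ distinct ⟩
  indicator ⊤ x + (indicator ⊤ y + indicator ⊤ z)
    ≡⟨ cong₂ _+_ (indicator-∈ {x = x} ∈⊤) (cong₂ _+_ (indicator-∈ {x = y} ∈⊤) (indicator-∈ {x = z} ∈⊤)) ⟩
  3                      ∎
  where open ≡-Reasoning

Nbhd : ThreeGraph n → Fin n → Fin n → Subset n
Nbhd H x y = Vec.tabulate (λ z → edge H (triple x y z))

∈Nbhd⁻ : (H : ThreeGraph n) → z ∈ Nbhd H x y → IsEdge H (triple x y z)
∈Nbhd⁻ {z = z} {x} {y} H m =
  trans (sym (lookup∘tabulate (λ z → edge H (triple x y z)) z)) ([]=⇒lookup m)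

∈Nbhd⁺ : (H : ThreeGraph n) → IsEdge H (triple x y z) → z ∈ Nbhd H x y
∈Nbhd⁺ {x = x} {y} {z} H e = lookup⇒[]= z _ (trans (lookup∘tabulate (λ z → edge H (triple x y z)) z) e)

length-filter≡∣tabulate∣ : {A : Set} (h : Fin n → A) (test : A → Bool) →
  length (filterᵇ test (List.tabulate h)) ≡ ∣ Vec.tabulate (test ∘ h) ∣
length-filter≡∣tabulate∣ {zero} h test = refl
length-filter≡∣tabulate∣ {suc n} h test with test (h Fin.zero)
... | true  = cong suc (length-filter≡∣tabulate∣ (h ∘ Fin.suc) test)
... | false = length-filter≡∣tabulate∣ (h ∘ Fin.suc) test

codeg≡∣Nbhd∣ : (H : ThreeGraph n) (x y : Fin n) → codeg H x y ≡ ∣ Nbhd H x y ∣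
codeg≡∣Nbhd∣ H x y = length-filter≡∣tabulate∣ (λ z → z) (λ z → edge H (triple x y z))

codeg-sym : (H : ThreeGraph n) (x y : Fin n) → codeg H x y ≡ codeg H y x
codeg-sym H x y = begin
  codeg H x y       ≡⟨ codeg≡∣Nbhd∣ H x y ⟩
  ∣ Nbhd H x y ∣    ≡⟨ cong ∣_∣ (tabulate-cong λ z → cong (edge H) (triple-swap₁₂ {x = x} {y = y} {z = z})) ⟩
  ∣ Nbhd H y x ∣    ≡⟨ sym (codeg≡∣Nbhd∣ H y x) ⟩
  codeg H y x       ∎
  where open ≡-Reasoning

∣p∣≤codeg : (H : ThreeGraph n) → (∀ {z} → z ∈ p → IsEdge H (triple x y z)) → ∣ p ∣ ≤ codeg H x y
∣p∣≤codeg {x = x} {y = y} H all-edges =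
  subst (_ ≤_) (sym (codeg≡∣Nbhd∣ H x y)) (p⊆q⇒∣p∣≤∣q∣ (∈Nbhd⁺ H ∘ all-edges))

-- Linking edges of an arbitrary 3-graph H into tight components.
module Tight {n : ℕ} (H : ThreeGraph n) where

  infix 4 _~_
  _~_ : Subset n → Subset n → Set
  _~_ = SameTightComponent H

  edge-distinct : ∀ {x y z} → IsEdge H (triple x y z) → Distinct x y z
  edge-distinct {x} {y} {z} e = ∣triple∣≡3⇒Distinct (edge-3 H (triple x y z) e)

  share-pair : ∀ {a b c d} → IsEdge H (triple a b c) → IsEdge H (triple a b d) →
               triple a b c ~ triple a b d
  share-pair {a} {b} {c} {d} abc abd with c ≟ d
  ... | yes refl = ε
  ... | no c≢d   = (abc , abd , meet) ◅ ε
    where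
    c∉abd : c ∉ triple a b d
    c∉abd m with ∈triple⁻ m | edge-distinct abc
    ... | inj₁ refl        | (_ , a≢c , _) = a≢c refl
    ... | inj₂ (inj₁ refl) | (_ , _ , b≢c) = b≢c refl
    ... | inj₂ (inj₂ c≡d)  | _             = c≢d c≡d
    meet : ∣ triple a b c ∩ triple a b d ∣ ≡ 2
    meet = trans (∣triple∩p∣ (triple a b d) (edge-distinct abc))
      (cong₂ _+_ (indicator-∈ {x = a} ∈triple₁)
        (cong₂ _+_ (indicator-∈ {x = b} ∈triple₂) (indicator-∉ c∉abd)))

  -- For edges {a, b, c} and {a, d, e} through a common vertex a, a bridge is
  -- a way to link them through the pairs at a: b = d, or {a, b, d} is an edge,
  -- or b and d have a common neighbour w with a.
  Bridge : Fin n → Fin n → Fin n → Set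
  Bridge a b d = b ≡ d ⊎ IsEdge H (triple a b d)
               ⊎ ∃[ w ] (IsEdge H (triple a b w) × IsEdge H (triple a d w))

  bridge? : ∀ a b d → Dec (Bridge a b d)
  bridge? a b d = (b ≟ d) ⊎-dec (edge H (triple a b d) Bool.≟ true) ⊎-dec
    any? (λ w → (edge H (triple a b w) Bool.≟ true) ×-dec (edge H (triple a d w) Bool.≟ true))

  share-vertex : ∀ {a b c d e} → IsEdge H (triple a b c) → IsEdge H (triple a d e) →
                 Bridge a b d → triple a b c ~ triple a d e
  share-vertex abc ade (inj₁ refl) = share-pair abc ade
  share-vertex abc ade (inj₂ (inj₁ abd)) =
    share-pair abc abd ◅◅ subst (_~ _) triple-swap₂₃ (share-pair (subst (IsEdge H) triple-swap₂₃ abd) ade)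
  share-vertex abc ade (inj₂ (inj₂ (w , abw , adw))) =
    share-pair abc abw
    ◅◅ subst₂ _~_ triple-swap₂₃ triple-swap₂₃
         (share-pair (subst (IsEdge H) triple-swap₂₃ abw) (subst (IsEdge H) triple-swap₂₃ adw))
    ◅◅ share-pair adw ade

  -- If {a, b, c} and {a, d, e} admit no bridge, then the neighbourhoods
  -- N(a, b), N(a, d) and the set {a, b, d} are pairwise disjoint subsets of
  -- the n vertices, so  codeg(a, b) + codeg(a, d) + 3 ≤ n.
  no-bridge-bound : ∀ {a b c d e} → IsEdge H (triple a b c) → IsEdge H (triple a d e) →
                    ¬ Bridge a b d → codeg H a b + codeg H a d + 3 ≤ n
  no-bridge-bound {a} {b} {c} {d} {e} abc ade no-bridge =
    subst (_≤ n) sizes (∣p∣≤n ((N₁ ∪ N₂) ∪ triple a b d))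
    where
    N₁ N₂ : Subset n
    N₁ = Nbhd H a b
    N₂ = Nbhd H a d
    outside : ∀ {u v w} → IsEdge H (triple a u w) → ¬ IsEdge H (triple a u v) → w ∉ triple a u v
    outside auw not-auv m with ∈triple⁻ m | edge-distinct auw
    ... | inj₁ refl        | (_ , a≢w , _) = a≢w refl
    ... | inj₂ (inj₁ refl) | (_ , _ , u≢w) = u≢w refl
    ... | inj₂ (inj₂ refl) | _             = not-auv auw
    not-abd : ¬ IsEdge H (triple a b d)
    not-abd = no-bridge ∘ inj₂ ∘ inj₁
    N₁∩N₂-empty : ∀ {w} → w ∈ N₁ → w ∉ N₂
    N₁∩N₂-empty {w} w∈N₁ w∈N₂ = no-bridge (inj₂ (inj₂ (w , ∈Nbhd⁻ H w∈N₁ , ∈Nbhd⁻ H w∈N₂)))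
    N₁∪N₂-outside : ∀ {w} → w ∈ N₁ ∪ N₂ → w ∉ triple a b d
    N₁∪N₂-outside m with x∈p∪q⁻ N₁ N₂ m
    ... | inj₁ w∈N₁ = outside (∈Nbhd⁻ H w∈N₁) not-abd
    ... | inj₂ w∈N₂ = subst (_ ∉_) (sym triple-swap₂₃)
                        (outside (∈Nbhd⁻ H w∈N₂) (not-abd ∘ subst (IsEdge H) triple-swap₂₃))
    a≢b = proj₁ (edge-distinct abc)
    a≢d = proj₁ (edge-distinct ade)
    b≢d = no-bridge ∘ inj₁
    sizes : ∣ (N₁ ∪ N₂) ∪ triple a b d ∣ ≡ codeg H a b + codeg H a d + 3
    sizes = begin
      ∣ (N₁ ∪ N₂) ∪ triple a b d ∣        ≡⟨ ∣p∪q∣-disjoint (N₁ ∪ N₂) (triple a b d) N₁∪N₂-outside ⟩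
      ∣ N₁ ∪ N₂ ∣ + ∣ triple a b d ∣      ≡⟨ cong₂ _+_ (∣p∪q∣-disjoint N₁ N₂ N₁∩N₂-empty)
                                                       (∣triple∣≡3 (a≢b , a≢d , b≢d)) ⟩
      ∣ N₁ ∣ + ∣ N₂ ∣ + 3                 ≡⟨ sym (cong₂ (λ s t → s + t + 3) (codeg≡∣Nbhd∣ H a b)
                                                                          (codeg≡∣Nbhd∣ H a d)) ⟩
      codeg H a b + codeg H a d + 3       ∎
      where open ≡-Reasoning

average-bound : ∀ m x y → m < 2 * x + 3 → m < 2 * y + 3 → m < x + y + 3
average-bound m x y m<2x+3 m<2y+3 = *-cancelˡ-≤ 2 (begin
  2 * suc m                     ≡⟨ solve 1 (λ m → con 2 :* (con 1 :+ m) := (con 1 :+ m) :+ (con 1 :+ m))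
                                         refl m ⟩
  suc m + suc m                 ≤⟨ +-mono-≤ m<2x+3 m<2y+3 ⟩
  (2 * x + 3) + (2 * y + 3)     ≡⟨ solve 2 (λ x y → (con 2 :* x :+ con 3) :+ (con 2 :* y :+ con 3)
                                                    := con 2 :* (x :+ y :+ con 3)) refl x y ⟩
  2 * (x + y + 3)               ∎)
  where
  open ≤-Reasoning
  open +-*-Solver

positive-codegree : ∀ {m c} → 3 ≤ m → m < 2 * c + 3 → 0 < c
positive-codegree {c = zero}  3≤m m<3 = contradiction 3≤m (<⇒≱ m<3)
positive-codegree {c = suc c} _   _   = s≤s z≤n

module Dense {n : ℕ} (H : ThreeGraph n) (dense : MinCodegreeAboveHalf H) where
  open Tight H

  bridge : ∀ {a b c d e} → IsEdge H (triple a b c) → IsEdge H (triple a d e) → Bridge a b d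
  bridge {a} {b} {c} {d} {e} abc ade with bridge? a b d
  ... | yes bridged = bridged
  ... | no no-bridge = contradiction (no-bridge-bound abc ade no-bridge) (<⇒≱ n<sum)
    where
    n<sum : n < codeg H a b + codeg H a d + 3
    n<sum = average-bound n (codeg H a b) (codeg H a d)
              (dense a b (proj₁ (edge-distinct abc))) (dense a d (proj₁ (edge-distinct ade)))

  -- Any two distinct vertices lie in a common edge, provided H has an edge at all:
  -- then n ≥ 3, so n < 2 codeg(x, y) + 3 forces codeg(x, y) > 0.
  common-edge : ∀ {e} x y → IsEdge H e → x ≢ y → ∃[ w ] IsEdge H (triple x y w)
  common-edge {e} x y e-edge x≢y =
    let (w , w∈N) = 0<∣p∣⇒Nonempty (subst (0 <_) (codeg≡∣Nbhd∣ H x y) positive) in w , ∈Nbhd⁻ H w∈N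
    where
    3≤n : 3 ≤ n
    3≤n = subst (_≤ n) (edge-3 H e e-edge) (∣p∣≤n e)
    positive : 0 < codeg H x y
    positive = positive-codegree 3≤n (dense x y x≢y)

  through-vertex : ∀ {a b c d e} → IsEdge H (triple a b c) → IsEdge H (triple a d e) →
                   triple a b c ~ triple a d e
  through-vertex abc ade = share-vertex abc ade (bridge abc ade)

  -- Edges {a, b, c} and {d, g, h} with a ≠ d are both linked to an edge {a, d, w}.
  tightly-connected : TightlyConnected H
  tightly-connected e f e-edge f-edge
    with ∣e∣≡3⇒triple {e = e} (edge-3 H e e-edge) | ∣e∣≡3⇒triple {e = f} (edge-3 H f f-edge)
  ... | a , b , c , refl | d , g , h , refl with a ≟ d
  ...   | yes refl = through-vertex e-edge f-edge
  ...   | no a≢d with common-edge a d e-edge a≢d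
  ...     | w , adw = through-vertex e-edge adw
                      ◅◅ subst (_~ _) triple-swap₁₂
                           (through-vertex (subst (IsEdge H) triple-swap₁₂ adw) f-edge)

witness : {P : Set} (d : Dec P) → does d ≡ true → P
witness (yes p) _ = p

∣replicate-true++replicate-false∣ : ∀ m l → ∣ Vec.replicate m true Vec.++ Vec.replicate l false ∣ ≡ m
∣replicate-true++replicate-false∣ zero    l = ∣⊥∣≡0 l
∣replicate-true++replicate-false∣ (suc m) l = cong suc (∣replicate-true++replicate-false∣ m l)

OddCount : ℕ → Set
OddCount m = m ≡ 1 ⊎ m ≡ 3

-- Touching preserves "all three vertices in A", which
-- separates {α₀, α₁, α₂} ⊆ A from {α₀, β₀, β₁}; every other edge is linked
-- to one of these two.
module Construction (k b' : ℕ) (k≤b' : k ≤ b') where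

  nA nB : ℕ
  nA = 3 + k
  nB = 2 + b'

  V : Set
  V = Fin (nA + nB)

  A : Subset (nA + nB)
  A = Vec.replicate nA true Vec.++ Vec.replicate nB false

  ∣A∣ : ∣ A ∣ ≡ nA
  ∣A∣ = ∣replicate-true++replicate-false∣ nA nB

  ∣∁A∣ : ∣ ∁ A ∣ ≡ nB
  ∣∁A∣ = trans (∣∁p∣≡n∸∣p∣ A) (trans (cong (nA + nB ∸_) ∣A∣) (m+n∸m≡n nA nB))

  edge? : (e : Subset (nA + nB)) → Dec (∣ e ∣ ≡ 3 × OddCount ∣ e ∩ A ∣)
  edge? e = (∣ e ∣ ℕ.≟ 3) ×-dec ((∣ e ∩ A ∣ ℕ.≟ 1) ⊎-dec (∣ e ∩ A ∣ ℕ.≟ 3))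

  -- The edge test is opaque, so edges are only handled through the two
  -- characterising lemmas (and the vertices of an edge {x, y, z} can be
  -- inferred from its type).
  opaque
    edge-test : Subset (nA + nB) → Bool
    edge-test e = does (edge? e)

    edge-test⁺ : ∀ {e} → ∣ e ∣ ≡ 3 → OddCount ∣ e ∩ A ∣ → edge-test e ≡ true
    edge-test⁺ {e} size odd = dec-true (edge? e) (size , odd)

    edge-test⁻ : ∀ {e} → edge-test e ≡ true → ∣ e ∣ ≡ 3 × OddCount ∣ e ∩ A ∣
    edge-test⁻ {e} is-edge = witness (edge? e) is-edge

  H : ThreeGraph (nA + nB)
  H = record { edge = edge-test ; edge-3 = λ e is-edge → proj₁ (edge-test⁻ is-edge) }

  open Tight H

  count : V → V → V → ℕ
  count x y z = indicator A x + (indicator A y + indicator A z)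

  count≡ : ∀ {x y z} (x? : Dec (x ∈ A)) (y? : Dec (y ∈ A)) (z? : Dec (z ∈ A)) →
           count x y z ≡ ⟦ x? ⟧ + (⟦ y? ⟧ + ⟦ z? ⟧)
  count≡ x? y? z? = cong₂ _+_ (indicator≡⟦⟧ x?) (cong₂ _+_ (indicator≡⟦⟧ y?) (indicator≡⟦⟧ z?))

  triple-edge⁺ : ∀ {x y z} → Distinct x y z → OddCount (count x y z) → IsEdge H (triple x y z)
  triple-edge⁺ distinct odd =
    edge-test⁺ (∣triple∣≡3 distinct) (subst OddCount (sym (∣triple∩p∣ A distinct)) odd)

  triple-edge⁻ : ∀ {x y z} → IsEdge H (triple x y z) → OddCount (count x y z)
  triple-edge⁻ is-edge =
    subst OddCount (∣triple∩p∣ A (edge-distinct is-edge)) (proj₂ (edge-test⁻ is-edge))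

  separated : ∀ {x y} → x ∈ A → y ∉ A → x ≢ y
  separated x∈A y∉A refl = y∉A x∈A

  edge-AAA : ∀ {x y z} → x ∈ A → y ∈ A → z ∈ A → Distinct x y z → IsEdge H (triple x y z)
  edge-AAA x∈A y∈A z∈A distinct =
    triple-edge⁺ distinct (subst OddCount (sym (count≡ (yes x∈A) (yes y∈A) (yes z∈A))) (inj₂ refl))

  edge-ABB : ∀ {x y z} → x ∈ A → y ∉ A → z ∉ A → y ≢ z → IsEdge H (triple x y z)
  edge-ABB x∈A y∉A z∉A y≢z =
    triple-edge⁺ (separated x∈A y∉A , separated x∈A z∉A , y≢z)
      (subst OddCount (sym (count≡ (yes x∈A) (no y∉A) (no z∉A))) (inj₁ refl))

  data Shape (x y z : V) : Set where
    inside : x ∈ A → y ∈ A → z ∈ A → Shape x y z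
    first  : x ∈ A → y ∉ A → z ∉ A → Shape x y z
    second : x ∉ A → y ∈ A → z ∉ A → Shape x y z
    third  : x ∉ A → y ∉ A → z ∈ A → Shape x y z

  shape : ∀ {x y z} → IsEdge H (triple x y z) → Shape x y z
  shape {x} {y} {z} is-edge =
    by-cases (x ∈? A) (y ∈? A) (z ∈? A)
      (subst OddCount (count≡ (x ∈? A) (y ∈? A) (z ∈? A)) (triple-edge⁻ is-edge))
    where
    by-cases : (x? : Dec (x ∈ A)) (y? : Dec (y ∈ A)) (z? : Dec (z ∈ A)) →
               OddCount (⟦ x? ⟧ + (⟦ y? ⟧ + ⟦ z? ⟧)) → Shape x y z
    by-cases (yes x∈A) (yes y∈A) (yes z∈A) _ = inside x∈A y∈A z∈A
    by-cases (yes x∈A) (no y∉A)  (no z∉A)  _ = first x∈A y∉A z∉A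
    by-cases (no x∉A)  (yes y∈A) (no z∉A)  _ = second x∉A y∈A z∉A
    by-cases (no x∉A)  (no y∉A)  (yes z∈A) _ = third x∉A y∉A z∈A
    by-cases (yes _) (yes _) (no _)  (inj₁ ())
    by-cases (yes _) (yes _) (no _)  (inj₂ ())
    by-cases (yes _) (no _)  (yes _) (inj₁ ())
    by-cases (yes _) (no _)  (yes _) (inj₂ ())
    by-cases (no _)  (yes _) (yes _) (inj₁ ())
    by-cases (no _)  (yes _) (yes _) (inj₂ ())
    by-cases (no _)  (no _)  (no _)  (inj₁ ())
    by-cases (no _)  (no _)  (no _)  (inj₂ ())

  opaque
    α₀ α₁ α₂ β₀ β₁ : V
    α₀ = Fin.zero
    α₁ = Fin.suc Fin.zero
    α₂ = Fin.suc (Fin.suc Fin.zero)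
    β₀ = nA ↑ʳ Fin.zero
    β₁ = nA ↑ʳ Fin.suc Fin.zero

    α₀∈A : α₀ ∈ A
    α₀∈A = here
    α₁∈A : α₁ ∈ A
    α₁∈A = there here
    α₂∈A : α₂ ∈ A
    α₂∈A = there (there here)

    α-distinct : Distinct α₀ α₁ α₂
    α-distinct = (λ ()) , (λ ()) , (λ ())

    β∉A : ∀ i → nA ↑ʳ i ∉ A
    β∉A i m with trans (sym ([]=⇒lookup m))
                   (trans (lookup-++ʳ (Vec.replicate nA true) (Vec.replicate nB false) i)
                          (lookup-replicate i false))
    ... | ()

    β₀∉A : β₀ ∉ A
    β₀∉A = β∉A Fin.zero
    β₁∉A : β₁ ∉ A
    β₁∉A = β∉A (Fin.suc Fin.zero)

    β₀≢β₁ : β₀ ≢ β₁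
    β₀≢β₁ eq with ↑ʳ-injective nA Fin.zero (Fin.suc Fin.zero) eq
    ... | ()

  ∣A∖x∖y∣ : ∀ {x y} → x ∈ A → y ∈ A → x ≢ y → ∣ A ∖ x ∖ y ∣ ≡ suc k
  ∣A∖x∖y∣ x∈A y∈A x≢y = suc-injective (suc-injective (trans (sym (∣p∣≡2+∣p∖x∖y∣ x∈A y∈A x≢y)) ∣A∣))

  -- A pair inside A completes to an edge with every other vertex of A.
  codeg-inside : ∀ {x y} → x ∈ A → y ∈ A → x ≢ y → suc k ≤ codeg H x y
  codeg-inside {x} {y} x∈A y∈A x≢y = subst (_≤ codeg H x y) (∣A∖x∖y∣ x∈A y∈A x≢y) (∣p∣≤codeg H completes)
    where
    completes : ∀ {z} → z ∈ A ∖ x ∖ y → IsEdge H (triple x y z)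
    completes z∈ = let (z∈A∖x , z≢y) = ∈∖⁻ z∈ ; (z∈A , z≢x) = ∈∖⁻ z∈A∖x in
      edge-AAA x∈A y∈A z∈A (x≢y , z≢x ∘ sym , z≢y ∘ sym)

  -- A pair outside A completes to an edge with every vertex of A.
  codeg-outside : ∀ {x y} → x ∉ A → y ∉ A → x ≢ y → suc k ≤ codeg H x y
  codeg-outside {x} {y} x∉A y∉A x≢y =
    ≤-trans (m≤n+m (suc k) 2) (subst (_≤ codeg H x y) ∣A∣ (∣p∣≤codeg H completes))
    where
    completes : ∀ {z} → z ∈ A → IsEdge H (triple x y z)
    completes z∈A = subst (IsEdge H) triple-rotate (edge-ABB z∈A x∉A y∉A x≢y)

  -- A pair across A and B completes to an edge with every other vertex of B,
  -- and B has at least k + 2 vertices.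
  codeg-across : ∀ {x y} → x ∈ A → y ∉ A → suc k ≤ codeg H x y
  codeg-across {x} {y} x∈A y∉A =
    ≤-trans (s≤s k≤b') (subst (_≤ codeg H x y) ∣∁A∖y∣ (∣p∣≤codeg H completes))
    where
    ∣∁A∖y∣ : ∣ ∁ A ∖ y ∣ ≡ suc b'
    ∣∁A∖y∣ = suc-injective (trans (sym (∣p∣≡1+∣p∖x∣ (x∉p⇒x∈∁p y∉A))) ∣∁A∣)
    completes : ∀ {z} → z ∈ ∁ A ∖ y → IsEdge H (triple x y z)
    completes z∈ = let (z∈∁A , z≢y) = ∈∖⁻ z∈ in edge-ABB x∈A y∉A (x∈∁p⇒x∉p z∈∁A) (z≢y ∘ sym)

  codeg-lower : ∀ x y → x ≢ y → suc k ≤ codeg H x y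
  codeg-lower x y x≢y with x ∈? A | y ∈? A
  ... | yes x∈A | yes y∈A = codeg-inside x∈A y∈A x≢y
  ... | no x∉A  | no y∉A  = codeg-outside x∉A y∉A x≢y
  ... | yes x∈A | no y∉A  = codeg-across x∈A y∉A
  ... | no x∉A  | yes y∈A = subst (suc k ≤_) (codeg-sym H y x) (codeg-across y∈A x∉A)

  Nbhd-inside : ∀ {x y} → x ∈ A → y ∈ A → Nbhd H x y ⊆ A ∖ x ∖ y
  Nbhd-inside x∈A y∈A z∈N with ∈Nbhd⁻ H z∈N
  ... | xyz with shape xyz | edge-distinct xyz
  ...   | inside _ _ z∈A | (_ , x≢z , y≢z) = ∈∖⁺ (∈∖⁺ z∈A (x≢z ∘ sym)) (y≢z ∘ sym)
  ...   | first _ y∉A _  | _ = contradiction y∈A y∉A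
  ...   | second x∉A _ _ | _ = contradiction x∈A x∉A
  ...   | third x∉A _ _  | _ = contradiction x∈A x∉A

  codeg-inside-exact : ∀ {x y} → x ∈ A → y ∈ A → x ≢ y → codeg H x y ≡ suc k
  codeg-inside-exact {x} {y} x∈A y∈A x≢y = ≤-antisym upper (codeg-inside x∈A y∈A x≢y)
    where
    upper : codeg H x y ≤ suc k
    upper = begin
      codeg H x y       ≡⟨ codeg≡∣Nbhd∣ H x y ⟩
      ∣ Nbhd H x y ∣    ≤⟨ p⊆q⇒∣p∣≤∣q∣ (Nbhd-inside x∈A y∈A) ⟩
      ∣ A ∖ x ∖ y ∣     ≡⟨ ∣A∖x∖y∣ x∈A y∈A x≢y ⟩
      suc k             ∎
      where open ≤-Reasoning

  min-codegree : MinCodegree H (suc k)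
  min-codegree = codeg-lower , α₀ , α₁ , α₀≢α₁ , codeg-inside-exact α₀∈A α₁∈A α₀≢α₁
    where α₀≢α₁ = proj₁ α-distinct

  -- Touching preserves "all three vertices in A": the two shared vertices lie
  -- in A, so the other edge meets A in at least two, hence (oddly) three vertices.
  InsideA : Subset (nA + nB) → Set
  InsideA e = ∣ e ∩ A ∣ ≡ 3

  touch-inside : ∀ {e f} → Touch H e f → InsideA e → InsideA f
  touch-inside {e} {f} (e-edge , f-edge , meet) e-inside with proj₂ (edge-test⁻ f-edge)
  ... | inj₂ f-inside = f-inside
  ... | inj₁ f-once   = contradiction
        (subst₂ _≤_ (cong₂ _+_ meet e-inside) (cong₂ _+_ (edge-3 H e e-edge) f-once) (overlap-bound e f A))
        (<⇒≱ ≤-refl)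

  ~-inside : ∀ {e f} → e ~ f → InsideA e → InsideA f
  ~-inside ε              e-inside = e-inside
  ~-inside (touch ◅ path) e-inside = ~-inside path (touch-inside touch e-inside)

  e₁ e₂ : Subset (nA + nB)
  e₁ = triple α₀ α₁ α₂
  e₂ = triple α₀ β₀ β₁

  αβ-distinct : Distinct α₀ β₀ β₁
  αβ-distinct = separated α₀∈A β₀∉A , separated α₀∈A β₁∉A , β₀≢β₁

  e₁-edge : IsEdge H e₁
  e₁-edge = edge-AAA α₀∈A α₁∈A α₂∈A α-distinct

  e₂-edge : IsEdge H e₂
  e₂-edge = edge-ABB α₀∈A β₀∉A β₁∉A β₀≢β₁

  e₁-inside : InsideA e₁
  e₁-inside = trans (∣triple∩p∣ A α-distinct)
                    (count≡ (yes α₀∈A) (yes α₁∈A) (yes α₂∈A))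

  e₂-outside : ∣ e₂ ∩ A ∣ ≡ 1
  e₂-outside = trans (∣triple∩p∣ A αβ-distinct)
                     (count≡ (yes α₀∈A) (no β₀∉A) (no β₁∉A))

  -- Inside A every triple is an edge, so two edges through a vertex x ∈ A,
  -- whose second vertices lie in A as well, are linked.
  A-bridge : ∀ {x y d} → x ∈ A → y ∈ A → d ∈ A → x ≢ y → x ≢ d → Bridge x y d
  A-bridge x∈A y∈A d∈A x≢y x≢d with _ ≟ _
  ... | yes y≡d = inj₁ y≡d
  ... | no y≢d  = inj₂ (inj₁ (edge-AAA x∈A y∈A d∈A (x≢y , x≢d , y≢d)))

  inside-through-vertex : ∀ {x y z u v} → x ∈ A → y ∈ A → u ∈ A →
    IsEdge H (triple x y z) → IsEdge H (triple x u v) → triple x y z ~ triple x u v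
  inside-through-vertex x∈A y∈A u∈A xyz xuv =
    share-vertex xyz xuv (A-bridge x∈A y∈A u∈A (proj₁ (edge-distinct xyz)) (proj₁ (edge-distinct xuv)))

  -- Every edge inside A is linked to e₁, through a vertex it shares with e₁ or
  -- through the edge {α₀, α₁, x}.
  inside-linked : ∀ {x y z} → x ∈ A → y ∈ A → z ∈ A → IsEdge H (triple x y z) → e₁ ~ triple x y z
  inside-linked {x} {y} {z} x∈A y∈A z∈A xyz with α₀ ≟ x
  ... | yes refl = inside-through-vertex α₀∈A α₁∈A y∈A e₁-edge xyz
  ... | no α₀≢x with α₁ ≟ x
  ...   | yes refl = subst (_~ triple α₁ y z) triple-swap₁₂
                       (inside-through-vertex α₁∈A α₀∈A y∈A (subst (IsEdge H) triple-swap₁₂ e₁-edge) xyz)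
  ...   | no α₁≢x  = inside-through-vertex α₀∈A α₁∈A α₁∈A e₁-edge α₀α₁x
                     ◅◅ subst (_~ triple x y z) triple-rotate
                          (inside-through-vertex x∈A α₀∈A y∈A (subst (IsEdge H) (sym triple-rotate) α₀α₁x) xyz)
    where
    α₀α₁x : IsEdge H (triple α₀ α₁ x)
    α₀α₁x = edge-AAA α₀∈A α₁∈A x∈A (proj₁ α-distinct , α₀≢x , α₁≢x)

  -- Outside A every pair completes to an edge with any vertex of A, so two
  -- edges through a vertex of A with their other vertices outside A are linked.
  B-bridge : ∀ {u y d} → u ∈ A → y ∉ A → d ∉ A → Bridge u y d
  B-bridge u∈A y∉A d∉A with _ ≟ _
  ... | yes y≡d = inj₁ y≡d
  ... | no y≢d  = inj₂ (inj₁ (edge-ABB u∈A y∉A d∉A y≢d))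

  -- Every edge {u, v, w} with only u in A is linked to e₂ through {β₀, β₁, u}.
  single-linked : ∀ {u v w} → u ∈ A → v ∉ A → w ∉ A → IsEdge H (triple u v w) → e₂ ~ triple u v w
  single-linked {u} {v} {w} u∈A v∉A w∉A uvw =
    subst (_~ triple β₀ β₁ u) (sym triple-rotate) (share-pair (subst (IsEdge H) triple-rotate e₂-edge) β₀β₁u)
    ◅◅ subst (_~ triple u v w) triple-rotate (share-vertex uβ₀β₁ uvw (B-bridge u∈A β₀∉A v∉A))
    where
    uβ₀β₁ = edge-ABB u∈A β₀∉A β₁∉A β₀≢β₁
    β₀β₁u = subst (IsEdge H) triple-rotate uβ₀β₁

  covered : ∀ f → IsEdge H f → e₁ ~ f ⊎ e₂ ~ f
  covered f f-edge with ∣e∣≡3⇒triple {e = f} (edge-3 H f f-edge)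
  ... | x , y , z , refl with shape f-edge
  ...   | inside x∈A y∈A z∈A = inj₁ (inside-linked x∈A y∈A z∈A f-edge)
  ...   | first x∈A y∉A z∉A  = inj₂ (single-linked x∈A y∉A z∉A f-edge)
  ...   | second x∉A y∈A z∉A = inj₂ (subst (e₂ ~_) triple-swap₁₂
                                  (single-linked y∈A x∉A z∉A (subst (IsEdge H) triple-swap₁₂ f-edge)))
  ...   | third x∉A y∉A z∈A  = inj₂ (subst (e₂ ~_) triple-rotate
                                  (single-linked z∈A x∉A y∉A (subst (IsEdge H) (sym triple-rotate) f-edge)))

  -- e₁ lies inside A and e₂ does not, so they are in different tight components.
  two-components : TwoTightComponents H
  two-components = e₁ , e₂ , e₁-edge , e₂-edge , separate , covered
    where
    separate : ¬ e₁ ~ e₂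
    separate e₁~e₂ with () ← trans (sym (~-inside e₁~e₂ e₁-inside)) e₂-outside

  extremal-graph : ∃[ H ] (MinCodegree H (suc k) × TwoTightComponents H)
  extremal-graph = H , min-codegree , two-components

-- For n ≥ 5 the construction has n vertices and minimum codegree ⌊(n - 3)/2⌋:
-- write n = 5 + t with t = 2q + r, r ≤ 1, and take k = q, b' = q + r.
extremal : ∀ n → 5 ≤ n → ∃[ H ] (MinCodegree {n} H ((n ∸ 3) / 2) × TwoTightComponents H)
extremal .(5 + t) (s≤s (s≤s (s≤s (s≤s (s≤s {n = t} _))))) =
  subst₂ Extremal size codegree (Construction.extremal-graph q (q + r) (m≤m+n q r))
  where
  q r : ℕ
  q = t / 2
  r = t % 2
  Extremal : ℕ → ℕ → Set
  Extremal m c = ∃[ H ] (MinCodegree {m} H c × TwoTightComponents H)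
  size : 3 + q + (2 + (q + r)) ≡ 5 + t
  size = begin
    3 + q + (2 + (q + r))  ≡⟨ solve 2 (λ q r → con 3 :+ q :+ (con 2 :+ (q :+ r)) := con 5 :+ (r :+ q :* con 2))
                                    refl q r ⟩
    5 + (r + q * 2)        ≡⟨ cong (5 +_) (sym (m≡m%n+[m/n]*n t 2)) ⟩
    5 + t                  ∎
    where
    open ≡-Reasoning
    open +-*-Solver
  codegree : suc q ≡ (2 + t) / 2
  codegree = sym (m/n≡1+[m∸n]/n {m = 2 + t} {n = 2} (s≤s (s≤s z≤n)))

proposition3p1 : (∀ n (H : ThreeGraph n) → MinCodegreeAboveHalf H → TightlyConnected H)
    × (∀ n → 5 ≤ n → ∃[ H ] (MinCodegree {n} H ((n ∸ 3) / 2) × TwoTightComponents H))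
proposition3p1 = (λ n H dense → Dense.tightly-connected H dense) , extremal
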